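{- For every term $\mathbf{t}$, context $\Gamma$ and type $T$: (1) if $\Gamma\vdash(\mathbf{0})~\mathbf{t}:T$ then $T\equiv\overline{0}$; (2) if $\Gamma\vdash(\mathbf{t})~\mathbf{0}:T$ then $T\equiv\overline{0}$.
   Context: Lineal terms over a commutative ring $(\mathcal{S},+,\times)$: basis terms $\mathbf{b}::=x\mid\lambda x\,\mathbf{t}$, terms $\mathbf{t}::=\mathbf{b}\mid(\mathbf{t})~\mathbf{r}\mid\mathbf{0}\mid\alpha.\mathbf{t}\mid\mathbf{t}+\mathbf{r}$, modulo AC of $+$. Scalar type system: types $T::=U\mid\forall X.T\mid\alpha.T\mid\overline{0}$, unit types $U::=X\mid U\to T\mid\forall X.U$, substitution of type variables only by unit types; $\equiv$ is the least congruence with $\alpha.\overline{0}\equiv\overline{0}$, $0.T\equiv\overline{0}$, $1.T\equiv T$, $\alpha.(\beta.T)\equiv(\alpha\times\beta).T$, $\forall X.\alpha.T\equiv\alpha.\forall X.T$. Contexts: finite sets of $x:U$ ($U$ unit). Rules: $\Gamma,x:U\vdash x:U$; from $\Gamma\vdash\mathbf{t}:T$, $T\equiv S$ infer $\Gamma\vdash\mathbf{t}:S$; from $\Gamma\vdash\mathbf{t}:\alpha.(U\to T)$, $\Gamma\vdash\mathbf{r}:\beta.U$ infer $\Gamma\vdash(\mathbf{t})~\mathbf{r}:(\alpha\times\beta).T$; from $\Gamma,x:U\vdash\mathbf{t}:T$ infer $\Gamma\vdash\lambda x\,\mathbf{t}:U\to T$; from $\Gamma\vdash\mathbf{t}:\forall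 X.T$ infer $\Gamma\vdash\mathbf{t}:T[U/X]$ ($U$ unit); from $\Gamma\vdash\mathbf{t}:T$ infer $\Gamma\vdash\mathbf{t}:\forall X.T$ if $X$ not free in $\Gamma$; $\Gamma\vdash\mathbf{0}:\overline{0}$; from $\Gamma\vdash\mathbf{t}:\alpha.T$, $\Gamma\vdash\mathbf{r}:\beta.T$ infer $\Gamma\vdash\mathbf{t}+\mathbf{r}:(\alpha+\beta).T$; from $\Gamma\vdash\mathbf{t}:T$ infer $\Gamma\vdash\alpha.\mathbf{t}:\alpha.T$. -}

module Defs where

open import Level using (_⊔_)
open import Algebra.Bundles using (CommutativeRing)
open import Data.Nat using (ℕ; zero; suc)
open import Data.List using (List; []; _∷_; map)
open import Data.List.Relation.Unary.All using (All)

-- Lineal terms and the scalar type system, over a commutative ring R.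
-- Variables (term and type) are de Bruijn indices.
module Lineal {c ℓ} (R : CommutativeRing c ℓ) where

  open CommutativeRing R using (_≈_; 0#; 1#) renaming (Carrier to S; _+_ to _+ₛ_; _*_ to _*ₛ_)

  infixr 7 _⇒_
  infixr 8 _·_

  data Type : Set c where
    tvar : ℕ → Type
    _⇒_  : Type → Type → Type
    ∀'   : Type → Type        -- ∀X. T  (binds index 0)
    _·_  : S → Type → Type
    𝟘    : Type

  mutual
    data IsUnit : Type → Set c where
      u-var : ∀ {n} → IsUnit (tvar n)
      u-arr : ∀ {U T} → IsUnit U → WF T → IsUnit (U ⇒ T)
      u-all : ∀ {U} → IsUnit U → IsUnit (∀' U)

    data WF : Type → Set c where
      wf-unit : ∀ {U} → IsUnit U → WF U
      wf-all  : ∀ {T} → WF T → WF (∀' T)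
      wf-scal : ∀ {α T} → WF T → WF (α · T)
      wf-zero : WF 𝟘

  ext : (ℕ → ℕ) → ℕ → ℕ
  ext ρ zero    = zero
  ext ρ (suc n) = suc (ρ n)

  rename : (ℕ → ℕ) → Type → Type
  rename ρ (tvar n) = tvar (ρ n)
  rename ρ (A ⇒ B)  = rename ρ A ⇒ rename ρ B
  rename ρ (∀' A)   = ∀' (rename (ext ρ) A)
  rename ρ (α · A)  = α · rename ρ A
  rename ρ 𝟘        = 𝟘

  exts : (ℕ → Type) → ℕ → Type
  exts σ zero    = tvar zero
  exts σ (suc n) = rename suc (σ n)

  subst : (ℕ → Type) → Type → Type
  subst σ (tvar n) = σ n
  subst σ (A ⇒ B)  = subst σ A ⇒ subst σ B
  subst σ (∀' A)   = ∀' (subst (exts σ) A)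
  subst σ (α · A)  = α · subst σ A
  subst σ 𝟘        = 𝟘

  -- T[U/X] where X is the variable bound by ∀' (index 0)
  _[_] : Type → Type → Type
  T [ U ] = subst σ T
    where
      σ : ℕ → Type
      σ zero    = U
      σ (suc n) = tvar n

  -- Type equivalence ≡ : least congruence with the given axioms.
  -- (Scalars are ring elements, so scalars equal in R give equal types.)
  infix 4 _≅_
  data _≅_ : Type → Type → Set (c ⊔ ℓ) where
    ≅-refl  : ∀ {A} → A ≅ A
    ≅-sym   : ∀ {A B} → A ≅ B → B ≅ A
    ≅-trans : ∀ {A B C} → A ≅ B → B ≅ C → A ≅ C
    ≅-⇒     : ∀ {A A' B B'} → A ≅ A' → B ≅ B' → (A ⇒ B) ≅ (A' ⇒ B')
    ≅-∀     : ∀ {A A'} → A ≅ A' → ∀' A ≅ ∀' A'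
    ≅-·     : ∀ {α β A A'} → α ≈ β → A ≅ A' → (α · A) ≅ (β · A')
    ax-α0   : ∀ {α} → (α · 𝟘) ≅ 𝟘
    ax-0T   : ∀ {T} → (0# · T) ≅ 𝟘
    ax-1T   : ∀ {T} → (1# · T) ≅ T
    ax-αβ   : ∀ {α β T} → (α · (β · T)) ≅ ((α *ₛ β) · T)
    ax-∀α   : ∀ {α T} → ∀' (α · T) ≅ (α · ∀' T)

  data Term : Set c where
    var  : ℕ → Term
    lam  : Term → Term
    app  : Term → Term → Term
    𝟎    : Term
    _•_  : S → Term → Term
    _⊕_  : Term → Term → Term

  -- terms are taken modulo associativity and commutativity of +
  infix 4 _~_
  data _~_ : Term → Term → Set c where
    ~-refl  : ∀ {t} → t ~ t
    ~-sym   : ∀ {t r} → t ~ r → r ~ t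
    ~-trans : ∀ {t r s} → t ~ r → r ~ s → t ~ s
    ~-lam   : ∀ {t t'} → t ~ t' → lam t ~ lam t'
    ~-app   : ∀ {t t' r r'} → t ~ t' → r ~ r' → app t r ~ app t' r'
    ~-•     : ∀ {α t t'} → t ~ t' → (α • t) ~ (α • t')
    ~-⊕     : ∀ {t t' r r'} → t ~ t' → r ~ r' → (t ⊕ r) ~ (t' ⊕ r')
    ~-comm  : ∀ {t r} → (t ⊕ r) ~ (r ⊕ t)
    ~-assoc : ∀ {t r s} → ((t ⊕ r) ⊕ s) ~ (t ⊕ (r ⊕ s))

  -- Contexts: lists of (unit) types; index 0 is the most recent binding
  Ctx : Set c
  Ctx = List Type

  data _∋_∶_ : Ctx → ℕ → Type → Set c where
    here  : ∀ {Γ U} → (U ∷ Γ) ∋ zero ∶ U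
    there : ∀ {Γ U V n} → Γ ∋ n ∶ U → (V ∷ Γ) ∋ suc n ∶ U

  -- shifting every type of the context (the new ∀-bound X is not free in Γ)
  ↑ctx : Ctx → Ctx
  ↑ctx Γ = map (rename suc) Γ

  infix 3 _⊢_∶_
  data _⊢_∶_ : Ctx → Term → Type → Set (c ⊔ ℓ) where
    ax    : ∀ {Γ n U} → Γ ∋ n ∶ U → Γ ⊢ var n ∶ U
    conv  : ∀ {Γ t T S'} → Γ ⊢ t ∶ T → T ≅ S' → Γ ⊢ t ∶ S'
    →E    : ∀ {Γ t r α β U T} → IsUnit U →
            Γ ⊢ t ∶ α · (U ⇒ T) → Γ ⊢ r ∶ β · U → Γ ⊢ app t r ∶ (α *ₛ β) · T
    →I    : ∀ {Γ t U T} → IsUnit U → (U ∷ Γ) ⊢ t ∶ T → Γ ⊢ lam t ∶ U ⇒ T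
    ∀E    : ∀ {Γ t T U} → IsUnit U → Γ ⊢ t ∶ ∀' T → Γ ⊢ t ∶ T [ U ]
    ∀I    : ∀ {Γ t T} → ↑ctx Γ ⊢ t ∶ T → Γ ⊢ t ∶ ∀' T
    ax0   : ∀ {Γ} → Γ ⊢ 𝟎 ∶ 𝟘
    +I    : ∀ {Γ t r α β T} → Γ ⊢ t ∶ α · T → Γ ⊢ r ∶ β · T → Γ ⊢ t ⊕ r ∶ (α +ₛ β) · T
    αI    : ∀ {Γ t α T} → Γ ⊢ t ∶ T → Γ ⊢ α • t ∶ α · T
    ac    : ∀ {Γ t r T} → t ~ r → Γ ⊢ t ∶ T → Γ ⊢ r ∶ T

module Submission where

open import Defs
open import Algebra.Bundles using (CommutativeRing)
open import Data.Bool using (Bool; true; false; _∨_; _∧_) renaming (T to True)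
open import Data.Bool.Properties using (∧-comm; ∧-assoc; T-∨; T-∧)
open import Data.List.Relation.Unary.All using (All)
open import Data.Nat using (zero; suc)
open import Data.Product using (_×_; _,_)
open import Data.Sum using (inj₁; inj₂)
open import Function.Bundles using (Equivalence)
open import Relation.Binary.PropositionalEquality as ≡ using (_≡_; refl; sym; trans; cong; cong₂)

-- Every type is equivalent to w.T₀ with w its total scalar weight, and w is
-- invariant under ≅ and under instantiation by unit types (which have weight 1).
-- In a derivation of (t) r the weight of the result is a product of the weights
-- of the premises, so it vanishes as soon as t or r has a type of weight 0; this
-- is the case for 𝟎, and, inductively, for every term assembled from 𝟎 by
-- applications, scalings and sums, a property that AC of + preserves.

module Weight {c ℓ} (R : CommutativeRing c ℓ) where
  open Lineal R
  open CommutativeRing R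
    using (_≈_; 0#; 1#; *-cong; +-cong; *-assoc; zeroˡ; zeroʳ; *-identityˡ; *-identityʳ;
           +-identityˡ; distribʳ; setoid)
    renaming (Carrier to S; reflexive to ≈-reflexive; _*_ to _*ₛ_; _+_ to _+ₛ_; refl to ≈-refl; sym to ≈-sym; trans to ≈-trans)
  open import Relation.Binary.Reasoning.Setoid setoid

  weight : Type → S
  weight (tvar n) = 1#
  weight (A ⇒ B)  = 1#
  weight (∀' A)   = weight A
  weight (α · A)  = α *ₛ weight A
  weight 𝟘        = 0#

  core : Type → Type
  core (tvar n) = tvar n
  core (A ⇒ B)  = A ⇒ B
  core (∀' A)   = ∀' (core A)
  core (α · A)  = core A
  core 𝟘        = 𝟘

  ≅-weight·core : ∀ A → A ≅ weight A · core A
  ≅-weight·core (tvar n) = ≅-sym ax-1T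
  ≅-weight·core (A ⇒ B)  = ≅-sym ax-1T
  ≅-weight·core (∀' A)   = ≅-trans (≅-∀ (≅-weight·core A)) ax-∀α
  ≅-weight·core (α · A)  = ≅-trans (≅-· ≈-refl (≅-weight·core A)) ax-αβ
  ≅-weight·core 𝟘        = ≅-sym ax-α0

  weight≈0⇒≅𝟘 : ∀ A → weight A ≈ 0# → A ≅ 𝟘
  weight≈0⇒≅𝟘 A w≈0 = ≅-trans (≅-weight·core A) (≅-trans (≅-· w≈0 ≅-refl) ax-0T)

  weight-resp-≅ : ∀ {A B} → A ≅ B → weight A ≈ weight B
  weight-resp-≅ ≅-refl        = ≈-refl
  weight-resp-≅ (≅-sym p)     = ≈-sym (weight-resp-≅ p)
  weight-resp-≅ (≅-trans p q) = ≈-trans (weight-resp-≅ p) (weight-resp-≅ q)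
  weight-resp-≅ (≅-⇒ p q)     = ≈-refl
  weight-resp-≅ (≅-∀ p)       = weight-resp-≅ p
  weight-resp-≅ (≅-· α≈β p)   = *-cong α≈β (weight-resp-≅ p)
  weight-resp-≅ ax-α0         = zeroʳ _
  weight-resp-≅ ax-0T         = zeroˡ _
  weight-resp-≅ ax-1T         = *-identityˡ _
  weight-resp-≅ (ax-αβ {α} {β} {A}) = ≈-sym (*-assoc α β (weight A))
  weight-resp-≅ ax-∀α         = ≈-refl

  weight-unit : ∀ {U} → IsUnit U → weight U ≈ 1#
  weight-unit u-var       = ≈-refl
  weight-unit (u-arr _ _) = ≈-refl
  weight-unit (u-all u)   = weight-unit u

  weight-rename : ∀ ρ A → weight (rename ρ A) ≡ weight A
  weight-rename ρ (tvar n) = refl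
  weight-rename ρ (A ⇒ B)  = refl
  weight-rename ρ (∀' A)   = weight-rename (ext ρ) A
  weight-rename ρ (α · A)  = cong (α *ₛ_) (weight-rename ρ A)
  weight-rename ρ 𝟘        = refl

  weight-subst : ∀ σ → (∀ n → weight (σ n) ≈ 1#) → ∀ A → weight (subst σ A) ≈ weight A
  weight-subst σ σ-weight1 (tvar n) = σ-weight1 n
  weight-subst σ σ-weight1 (A ⇒ B)  = ≈-refl
  weight-subst σ σ-weight1 (∀' A)   = weight-subst (exts σ) exts-weight1 A
    where
      exts-weight1 : ∀ n → weight (exts σ n) ≈ 1#
      exts-weight1 zero    = ≈-refl
      exts-weight1 (suc n) = ≈-trans (≈-reflexive (weight-rename suc (σ n))) (σ-weight1 n)
  weight-subst σ σ-weight1 (α · A)  = *-cong ≈-refl (weight-subst σ σ-weight1 A)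
  weight-subst σ σ-weight1 𝟘        = ≈-refl

  weight-[] : ∀ A {U} → IsUnit U → weight (A [ U ]) ≈ weight A
  weight-[] A u = weight-subst _ (λ { zero → weight-unit u ; (suc n) → ≈-refl }) A

  annihilated : Term → Bool
  annihilated 𝟎         = true
  annihilated (app t r) = annihilated t ∨ annihilated r
  annihilated (α • t)   = annihilated t
  annihilated (t ⊕ r)   = annihilated t ∧ annihilated r
  annihilated (var n)   = false
  annihilated (lam t)   = false

  annihilated-resp-~ : ∀ {t r} → t ~ r → annihilated t ≡ annihilated r
  annihilated-resp-~ ~-refl        = refl
  annihilated-resp-~ (~-sym p)     = sym (annihilated-resp-~ p)
  annihilated-resp-~ (~-trans p q) = trans (annihilated-resp-~ p) (annihilated-resp-~ q)
  annihilated-resp-~ (~-lam p)     = refl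
  annihilated-resp-~ (~-app p q)   = cong₂ _∨_ (annihilated-resp-~ p) (annihilated-resp-~ q)
  annihilated-resp-~ (~-• p)       = annihilated-resp-~ p
  annihilated-resp-~ (~-⊕ p q)     = cong₂ _∧_ (annihilated-resp-~ p) (annihilated-resp-~ q)
  annihilated-resp-~ (~-comm {t} {r})       = ∧-comm (annihilated t) (annihilated r)
  annihilated-resp-~ (~-assoc {t} {r} {s}) = ∧-assoc (annihilated t) (annihilated r) (annihilated s)

  *-weight≈0ˡ : ∀ {α β w} → α *ₛ 1# ≈ 0# → (α *ₛ β) *ₛ w ≈ 0#
  *-weight≈0ˡ {α} {β} {w} α1≈0 = begin
    (α *ₛ β) *ₛ w  ≈⟨ *-cong (*-cong (≈-trans (≈-sym (*-identityʳ α)) α1≈0) ≈-refl) ≈-refl ⟩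
    (0# *ₛ β) *ₛ w ≈⟨ *-cong (zeroˡ β) ≈-refl ⟩
    0# *ₛ w        ≈⟨ zeroˡ w ⟩
    0#             ∎

  *-weight≈0ʳ : ∀ {α β w u} → u ≈ 1# → β *ₛ u ≈ 0# → (α *ₛ β) *ₛ w ≈ 0#
  *-weight≈0ʳ {α} {β} {w} {u} u≈1 βu≈0 = begin
    (α *ₛ β) *ₛ w  ≈⟨ *-cong (*-cong ≈-refl β≈0) ≈-refl ⟩
    (α *ₛ 0#) *ₛ w ≈⟨ *-cong (zeroʳ α) ≈-refl ⟩
    0# *ₛ w        ≈⟨ zeroˡ w ⟩
    0#             ∎
    where
      β≈0 : β ≈ 0#
      β≈0 = ≈-trans (≈-sym (≈-trans (*-cong ≈-refl u≈1) (*-identityʳ β))) βu≈0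

  +-weight≈0 : ∀ {α β w} → α *ₛ w ≈ 0# → β *ₛ w ≈ 0# → (α +ₛ β) *ₛ w ≈ 0#
  +-weight≈0 {α} {β} {w} αw≈0 βw≈0 = begin
    (α +ₛ β) *ₛ w        ≈⟨ distribʳ w α β ⟩
    α *ₛ w +ₛ β *ₛ w     ≈⟨ +-cong αw≈0 βw≈0 ⟩
    0# +ₛ 0#             ≈⟨ +-identityˡ 0# ⟩
    0#                   ∎

  annihilated-weight≈0 : ∀ {Γ t A} → Γ ⊢ t ∶ A → True (annihilated t) → weight A ≈ 0#
  annihilated-weight≈0 (ax x) ()
  annihilated-weight≈0 (conv d p) n = ≈-trans (≈-sym (weight-resp-≅ p)) (annihilated-weight≈0 d n)
  annihilated-weight≈0 (→E {t = t} {r = r} u d e) n with Equivalence.to (T-∨ {annihilated t} {annihilated r}) n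
  ... | inj₁ nt = *-weight≈0ˡ (annihilated-weight≈0 d nt)
  ... | inj₂ nr = *-weight≈0ʳ (weight-unit u) (annihilated-weight≈0 e nr)
  annihilated-weight≈0 (→I u d) ()
  annihilated-weight≈0 (∀E {T = A} u d) n = ≈-trans (weight-[] A u) (annihilated-weight≈0 d n)
  annihilated-weight≈0 (∀I d) n = annihilated-weight≈0 d n
  annihilated-weight≈0 ax0 n = ≈-refl
  annihilated-weight≈0 (+I {t = t} {r = r} d e) n with Equivalence.to (T-∧ {annihilated t} {annihilated r}) n
  ... | nt , nr = +-weight≈0 (annihilated-weight≈0 d nt) (annihilated-weight≈0 e nr)
  annihilated-weight≈0 (αI {α = α} d) n = ≈-trans (*-cong ≈-refl (annihilated-weight≈0 d n)) (zeroʳ α)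
  annihilated-weight≈0 (ac p d) n =
    annihilated-weight≈0 d (≡.subst True (sym (annihilated-resp-~ p)) n)

  annihilated-≅𝟘 : ∀ {Γ t A} → Γ ⊢ t ∶ A → True (annihilated t) → A ≅ 𝟘
  annihilated-≅𝟘 {A = A} d n = weight≈0⇒≅𝟘 A (annihilated-weight≈0 d n)

mainTheorem17 : ∀ {c ℓ} (R : CommutativeRing c ℓ) → let open Lineal R in
    (t : Term) (Γ : Ctx) (T : Type) → All IsUnit Γ → WF T →
    ((Γ ⊢ app 𝟎 t ∶ T) → T ≅ 𝟘) × ((Γ ⊢ app t 𝟎 ∶ T) → T ≅ 𝟘)
mainTheorem17 R t Γ T _ _ = (λ d → annihilated-≅𝟘 d _) , (λ d → annihilated-≅𝟘 d zero-right)
  where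
    open Weight R
    zero-right : True (annihilated t ∨ true)
    zero-right = Equivalence.from (T-∨ {annihilated t}) (inj₂ _)
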